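{- Fix $k\geq 2$ and $n\geq (k-1)^2+1$. Suppose that whenever $F\subseteq S_k$ is reverse-closed, contains neither monotone pattern, and $p\in S_k\setminus F$ is a non-monotone pattern legal from $F$ (at length $n$), the reverse pattern $p^r$ is legal from $F\cup\{p\}$. Then the move-by-move reverse strategy is a winning strategy for Player II in PAP with pattern length $k$ on $S_n$. In particular, $S_n$ is a P-position.
   Context: $S_k$ is the set of permutations of $\{1,\dots,k\}$; $\pi^r$ is the reverse; the monotone patterns are $12\cdots k$ and $k\cdots 21$. For $F\subseteq S_k$, $\operatorname{Av}_n(F)$ is the set of $\pi\in S_n$ avoiding (classically) every pattern in $F$. $F$ is reverse-closed if $p\in F\iff p^r\in F$. A pattern $p$ is legal from $F$ at length $n$ if some permutation in $\operatorname{Av}_n(F)$ contains $p$. PAP with pattern length $k$: a position is $X\subseteq S_n$; a move chooses $p\in S_k$ contained in some permutation of $X$ and replaces $X$ by the permutations of $X$ avoiding $p$; normal play; Player I moves first from $S_n$. The move-by-move reverse strategy: Player II answers each move $p$ of Player I with $p^r$; it is winning if against every legal play of Player I every such reply is legal and Player II makes the last move. A P-position is one with Sprague--Grundy value $0$ (the previous player wins). -}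

module Defs where

open import Data.Nat as ℕ using (ℕ; zero; suc; _+_; _*_; _∸_; _≤_)
open import Data.Fin using (Fin; opposite) renaming (_<_ to _<ᶠ_)
open import Data.Fin.Properties using (opposite-involutive)
open import Data.Vec using (Vec; lookup; tabulate)
open import Data.Vec.Properties using (lookup∘tabulate)
open import Data.Product using (Σ; _×_; _,_; ∃)
open import Data.Sum using (_⊎_)
open import Data.Unit using (⊤)
open import Function using (id; _∘_)
open import Relation.Nullary using (¬_)
open import Relation.Binary.PropositionalEquality using (_≡_; refl; sym; trans; cong)

-- Permutations of {1,…,n}: the one-line notation π(1)…π(n) as a vector
-- of length n over Fin n, with an (irrelevant) injectivity proof, so
-- that two permutations are equal iff their one-line notations are.

record Perm (n : ℕ) : Set where
  constructor perm
  field
    word : Vec (Fin n) n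
    .injective : ∀ i j → lookup word i ≡ lookup word j → i ≡ j
open Perm public

_⟨_⟩ : ∀ {n} → Perm n → Fin n → Fin n
π ⟨ i ⟩ = lookup (word π) i

private
  tab-inj : ∀ {n} (f : Fin n → Fin n) →
            (∀ i j → f i ≡ f j → i ≡ j) →
            ∀ i j → lookup (tabulate f) i ≡ lookup (tabulate f) j → i ≡ j
  tab-inj f inj i j eq =
    inj i j (trans (sym (lookup∘tabulate f i)) (trans eq (lookup∘tabulate f j)))

  opp-inj : ∀ {n} (i j : Fin n) → opposite i ≡ opposite j → i ≡ j
  opp-inj i j eq =
    trans (sym (opposite-involutive i)) (trans (cong opposite eq) (opposite-involutive j))

rev : ∀ {n} → Perm n → Perm n
rev (perm w inj) = perm (tabulate (λ i → lookup w (opposite i)))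
  (tab-inj (λ i → lookup w (opposite i))
     (λ i j eq → opp-inj i j (inj (opposite i) (opposite j) eq)))

incr : ∀ k → Perm k
incr k = perm (tabulate id) (tab-inj id (λ i j eq → eq))

decr : ∀ k → Perm k
decr k = perm (tabulate opposite) (tab-inj opposite opp-inj)

Monotone : ∀ {k} → Perm k → Set
Monotone {k} p = (p ≡ incr k) ⊎ (p ≡ decr k)

Contains : ∀ {n k} → Perm n → Perm k → Set
Contains {n} {k} π p =
  Σ (Fin k → Fin n) λ f →
    (∀ i j → i <ᶠ j → f i <ᶠ f j) ×
    (∀ i j → (p ⟨ i ⟩ <ᶠ p ⟨ j ⟩ → π ⟨ f i ⟩ <ᶠ π ⟨ f j ⟩) ×
             (π ⟨ f i ⟩ <ᶠ π ⟨ f j ⟩ → p ⟨ i ⟩ <ᶠ p ⟨ j ⟩))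

Avoids : ∀ {n k} → Perm n → Perm k → Set
Avoids π p = ¬ Contains π p

PatSet : ℕ → Set₁
PatSet k = Perm k → Set

Av : ∀ {k} (n : ℕ) → PatSet k → Perm n → Set
Av n F π = ∀ q → F q → Avoids π q

ReverseClosed : ∀ {k} → PatSet k → Set
ReverseClosed F = ∀ p → (F p → F (rev p)) × (F (rev p) → F p)

_∪｛_｝ : ∀ {k} → PatSet k → Perm k → PatSet k
(F ∪｛ p ｝) q = F q ⊎ q ≡ p

LegalFrom : ∀ {k} (n : ℕ) → PatSet k → Perm k → Set
LegalFrom n F p = ∃ λ π → Av n F π × Contains π p

Position : ℕ → Set₁
Position n = Perm n → Set

Sₙ : ∀ n → Position n
Sₙ n _ = ⊤

LegalMove : ∀ {n k} → Position n → Perm k → Set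
LegalMove X p = ∃ λ π → X π × Contains π p

_after_ : ∀ {n k} → Position n → Perm k → Position n
(X after p) π = X π × Avoids π p

-- The
-- type is inductive, so every play is finite and ends with Player I
-- unable to move, i.e. Player II makes the last move (normal play).
data ReverseStrategyWins {n} (k : ℕ) (X : Position n) : Set₁ where
  wins : (∀ (p : Perm k) → LegalMove X p →
            LegalMove (X after p) (rev p) ×
            ReverseStrategyWins k ((X after p) after rev p)) →
         ReverseStrategyWins k X

-- Normal-play outcomes: P = previous player wins (Sprague–Grundy value 0),
-- N = next player wins.
mutual
  data IsP {n} (k : ℕ) (X : Position n) : Set₁ where
    allMovesToN : (∀ (p : Perm k) → LegalMove X p → IsN k (X after p)) → IsP k X

  data IsN {n} (k : ℕ) (X : Position n) : Set₁ where
    moveToP : (p : Perm k) → LegalMove X p → IsP k (X after p) → IsN k X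

{-# OPTIONS --safe #-}

-- Since n > (k - 1)², by the Erdős–Szekeres theorem every permutation in S_n contains
-- 12⋯k or k⋯21.  Player II keeps the position equal to Av_n(F) for some F that is
-- reverse-closed and free of monotone patterns.  A non-monotone move p preserves this
-- after the reply p^r, which is legal by hypothesis.  A monotone move, say 12⋯k, is
-- answered by k⋯21, legal via n⋯21 (whose only pattern of length k is k⋯21); after it
-- no permutation avoids both monotone patterns, so Player I cannot move.  Every move
-- forbids a new pattern of S_k, so the play is finite.

module Submission where

open import Defs
open import Data.Nat as ℕ using (ℕ; zero; suc; _+_; _*_; _∸_; _^_; _≤_; _<_; z≤n; s≤s; z<s; s<s; s<s⁻¹)
import Data.Nat.Properties as ℕ
open import Data.Fin as Fin
  using (Fin; zero; suc; toℕ; opposite; inject₁; inject≤; combine; fromℕ<; funToFin; finToFun; _>_)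
  renaming (_<_ to _<ᶠ_)
import Data.Fin.Properties as Fin
open import Data.Fin.Induction using (<-weakInduction)
open import Data.Vec using (lookup; tabulate)
open import Data.Vec.Properties using (lookup∘tabulate; tabulate∘lookup; tabulate-cong; ≡-dec)
open import Data.List as List using (List; []; _∷_; length)
open import Data.List.Relation.Unary.All as All using (All; []; _∷_)
open import Data.List.Relation.Unary.All.Properties using (¬Any⇒All¬)
open import Data.List.Relation.Unary.Any using (here; there)
open import Data.List.Relation.Unary.AllPairs using ([]; _∷_)
open import Data.List.Relation.Unary.Unique.Propositional using (Unique)
open import Data.List.Membership.Propositional using (_∈_; _∉_)
open import Data.List.Membership.Propositional.Properties using (∈-tabulate⁺; ∈-lookup)
open import Data.List.Extrema ℕ.≤-totalOrder using (argmax; f[xs]≤f[argmax])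
open import Data.Product using (∃; _×_; _,_; proj₁; proj₂; map₁)
open import Data.Sum using (_⊎_; inj₁; inj₂; [_,_]′)
open import Data.Unit using (tt)
open import Data.Empty using (⊥; ⊥-elim; ⊥-elim-irr)
open import Function using (id; _∘_)
open import Level using (0ℓ)
open import Relation.Binary using (Rel; Decidable; Transitive; DecidableEquality; tri<; tri≈; tri>; _Preserves_⟶_)
open import Relation.Binary.PropositionalEquality
  using (_≡_; _≢_; refl; sym; trans; cong; subst; subst₂; _≗_; module ≡-Reasoning)
open import Relation.Nullary using (¬_; Dec; yes; no; contradiction)
open import Relation.Nullary.Decidable using (map′; _⊎-dec_)
open import Relation.Unary using (_⊆′_; _≐′_)

private
  variable
    k m n : ℕ

word-injective : {p q : Perm n} → word p ≡ word q → p ≡ q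
word-injective {p = perm w _} {perm .w _} refl = refl

perm-ext : {p q : Perm n} → (∀ i → p ⟨ i ⟩ ≡ q ⟨ i ⟩) → p ≡ q
perm-ext {p = p} {q} p≗q = word-injective (begin
  word p           ≡⟨ tabulate∘lookup (word p) ⟨
  tabulate (p ⟨_⟩) ≡⟨ tabulate-cong p≗q ⟩
  tabulate (q ⟨_⟩) ≡⟨ tabulate∘lookup (word q) ⟩
  word q           ∎)
  where open ≡-Reasoning

-- The injectivity field is irrelevant; deciding i ≡ j recovers a relevant proof.
⟨⟩-injective : (π : Perm n) {i j : Fin n} → π ⟨ i ⟩ ≡ π ⟨ j ⟩ → i ≡ j
⟨⟩-injective (perm w inj) {i} {j} eq with i Fin.≟ j
... | yes i≡j = i≡j
... | no i≢j = ⊥-elim-irr (i≢j (inj i j eq))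

_≟_ : DecidableEquality (Perm n)
p ≟ q = map′ word-injective (cong word) (≡-dec Fin._≟_ (word p) (word q))

rev⟨⟩ : (p : Perm n) (i : Fin n) → rev p ⟨ i ⟩ ≡ p ⟨ opposite i ⟩
rev⟨⟩ (perm w _) i = lookup∘tabulate (λ i → lookup w (opposite i)) i

incr⟨⟩ : (i : Fin n) → incr n ⟨ i ⟩ ≡ i
incr⟨⟩ i = lookup∘tabulate id i

decr⟨⟩ : (i : Fin n) → decr n ⟨ i ⟩ ≡ opposite i
decr⟨⟩ i = lookup∘tabulate opposite i

rev-involutive : (p : Perm n) → rev (rev p) ≡ p
rev-involutive p = perm-ext λ i → begin
  rev (rev p) ⟨ i ⟩           ≡⟨ rev⟨⟩ (rev p) i ⟩
  rev p ⟨ opposite i ⟩        ≡⟨ rev⟨⟩ p (opposite i) ⟩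
  p ⟨ opposite (opposite i) ⟩ ≡⟨ cong (p ⟨_⟩) (Fin.opposite-involutive i) ⟩
  p ⟨ i ⟩                     ∎
  where open ≡-Reasoning

rev-incr : rev (incr n) ≡ decr n
rev-incr {n} = perm-ext λ i →
  trans (rev⟨⟩ (incr n) i) (trans (incr⟨⟩ (opposite i)) (sym (decr⟨⟩ i)))

rev-decr : rev (decr n) ≡ incr n
rev-decr {n} = trans (cong rev (sym (rev-incr {n}))) (rev-involutive (incr n))

incr-≢-decr : incr (suc (suc k)) ≢ decr (suc (suc k))
incr-≢-decr eq with cong (_⟨ zero ⟩) eq
... | ()

monotone? : (p : Perm k) → Dec (Monotone p)
monotone? {k} p = (p ≟ incr k) ⊎-dec (p ≟ decr k)

rev-monotone : {p : Perm k} → Monotone p → Monotone (rev p)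
rev-monotone (inj₁ refl) = inj₂ rev-incr
rev-monotone (inj₂ refl) = inj₁ rev-decr

rev-nonmonotone : {p : Perm k} → ¬ Monotone p → ¬ Monotone (rev p)
rev-nonmonotone {p = p} ¬mono mono =
  ¬mono (subst Monotone (rev-involutive p) (rev-monotone mono))

-- Strictly monotone maps between finite ordinals

opposite-< : {i j : Fin n} → i <ᶠ j → opposite i > opposite j
opposite-< {n} {i} {j} i<j = subst₂ _<_ (sym (Fin.opposite-prop j)) (sym (Fin.opposite-prop i))
  (ℕ.∸-monoʳ-< (s≤s i<j) (Fin.toℕ<n j))

increasing-reflects-< : {f : Fin k → Fin m} → f Preserves _<ᶠ_ ⟶ _<ᶠ_ →
                        ∀ {i j} → f i <ᶠ f j → i <ᶠ j
increasing-reflects-< f-inc {i} {j} fi<fj with Fin.<-cmp i j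
... | tri< i<j _ _ = i<j
... | tri≈ _ refl _ = contradiction fi<fj (Fin.<-irrefl refl)
... | tri> _ _ j<i = contradiction (f-inc j<i) (Fin.<-asym fi<fj)

decreasing-reflects-< : {f : Fin k → Fin m} → f Preserves _<ᶠ_ ⟶ _>_ →
                        ∀ {i j} → f i <ᶠ f j → i > j
decreasing-reflects-< f-dec fi<fj = increasing-reflects-< (opposite-< ∘ f-dec) (opposite-< fi<fj)

increasing⇒≥ : {f : Fin k → Fin m} → f Preserves _<ᶠ_ ⟶ _<ᶠ_ → ∀ i → toℕ i ≤ toℕ (f i)
increasing⇒≥ {suc k} {f = f} f-inc = <-weakInduction (λ i → toℕ i ≤ toℕ (f i)) z≤n step
  where
  open ℕ.≤-Reasoning
  step : ∀ i → toℕ (inject₁ i) ≤ toℕ (f (inject₁ i)) → toℕ (suc i) ≤ toℕ (f (suc i))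
  step i ih = begin
    suc (toℕ i)               ≡⟨ cong suc (Fin.toℕ-inject₁ i) ⟨
    suc (toℕ (inject₁ i))     ≤⟨ s≤s ih ⟩
    suc (toℕ (f (inject₁ i))) ≤⟨ f-inc (Fin.≤̄⇒inject₁< ℕ.≤-refl) ⟩
    toℕ (f (suc i))           ∎

increasing⇒≗id : {f : Fin k → Fin k} → f Preserves _<ᶠ_ ⟶ _<ᶠ_ → f ≗ id
increasing⇒≗id {f = f} f-inc i = Fin.toℕ-injective (ℕ.≤-antisym fi≤i (increasing⇒≥ f-inc i))
  where
  conjugate-inc : (opposite ∘ f ∘ opposite) Preserves _<ᶠ_ ⟶ _<ᶠ_
  conjugate-inc = opposite-< ∘ f-inc ∘ opposite-<
  opposite-bound : toℕ (opposite i) ≤ toℕ (opposite (f i))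
  opposite-bound = subst (λ j → toℕ (opposite i) ≤ toℕ (opposite (f j)))
    (Fin.opposite-involutive i) (increasing⇒≥ conjugate-inc (opposite i))
  fi≤i : toℕ (f i) ≤ toℕ i
  fi≤i = ℕ.≮⇒≥ λ i<fi → ℕ.<⇒≱ (opposite-< i<fi) opposite-bound

increasing-subsequence⇒incr : (π : Perm n) (f : Fin k → Fin n) →
  f Preserves _<ᶠ_ ⟶ _<ᶠ_ → (π ⟨_⟩ ∘ f) Preserves _<ᶠ_ ⟶ _<ᶠ_ → Contains π (incr k)
increasing-subsequence⇒incr π f f-inc πf-inc = f , (λ _ _ → f-inc) , λ i j →
  (λ lt → πf-inc (subst₂ _<ᶠ_ (incr⟨⟩ i) (incr⟨⟩ j) lt)) ,
  (λ lt → subst₂ _<ᶠ_ (sym (incr⟨⟩ i)) (sym (incr⟨⟩ j)) (increasing-reflects-< πf-inc lt))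

decreasing-subsequence⇒decr : (π : Perm n) (f : Fin k → Fin n) →
  f Preserves _<ᶠ_ ⟶ _<ᶠ_ → (π ⟨_⟩ ∘ f) Preserves _<ᶠ_ ⟶ _>_ → Contains π (decr k)
decreasing-subsequence⇒decr π f f-inc πf-dec = f , (λ _ _ → f-inc) , λ i j →
  (λ lt → πf-dec (decreasing-reflects-< opposite-< (subst₂ _<ᶠ_ (decr⟨⟩ i) (decr⟨⟩ j) lt))) ,
  (λ lt → subst₂ _<ᶠ_ (sym (decr⟨⟩ i)) (sym (decr⟨⟩ j)) (opposite-< (decreasing-reflects-< πf-dec lt)))

incr-contains⇒incr : {q : Perm k} → Contains (incr n) q → q ≡ incr k
incr-contains⇒incr {q = q} (f , f-inc , f-iso) =
  perm-ext λ i → trans (increasing⇒≗id q-inc i) (sym (incr⟨⟩ i))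
  where
  q-inc : (q ⟨_⟩) Preserves _<ᶠ_ ⟶ _<ᶠ_
  q-inc {i} {j} i<j =
    proj₂ (f-iso i j) (subst₂ _<ᶠ_ (sym (incr⟨⟩ (f i))) (sym (incr⟨⟩ (f j))) (f-inc i j i<j))

decr-contains⇒decr : {q : Perm k} → Contains (decr n) q → q ≡ decr k
decr-contains⇒decr {q = q} (f , f-inc , f-iso) = perm-ext λ i → begin
  q ⟨ i ⟩                       ≡⟨ Fin.opposite-involutive (q ⟨ i ⟩) ⟨
  opposite (opposite (q ⟨ i ⟩)) ≡⟨ cong opposite (increasing⇒≗id opposite-q-inc i) ⟩
  opposite i                    ≡⟨ decr⟨⟩ i ⟨
  decr _ ⟨ i ⟩                  ∎
  where
  open ≡-Reasoning
  opposite-q-inc : (opposite ∘ q ⟨_⟩) Preserves _<ᶠ_ ⟶ _<ᶠ_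
  opposite-q-inc {i} {j} i<j = opposite-< (proj₂ (f-iso j i)
    (subst₂ _<ᶠ_ (sym (decr⟨⟩ (f j))) (sym (decr⟨⟩ (f i))) (opposite-< (f-inc i j i<j))))

-- The Erdős–Szekeres theorem

module Chains {A : Set} (_R_ : Rel A 0ℓ) (R? : Decidable _R_) (R-trans : Transitive _R_) where

  record Chain (s : Fin n → A) (m : ℕ) (a : Fin n) : Set where
    field
      pos : Fin (suc m) → Fin n
      starts : pos zero ≡ a
      increasing : pos Preserves _<ᶠ_ ⟶ _<ᶠ_
      related : ∀ {i j} → i <ᶠ j → s (pos i) R s (pos j)

  singleton : {s : Fin n → A} {a : Fin n} → Chain s 0 a
  singleton {a = a} = record
    { pos        = λ _ → a
    ; starts     = refl
    ; increasing = λ { {zero} {zero} () }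
    ; related    = λ { {zero} {zero} () }
    }

  shift : {s : Fin (suc n) → A} {b : Fin n} → Chain (s ∘ suc) m b → Chain s m (suc b)
  shift c = record
    { pos        = suc ∘ pos
    ; starts     = cong suc starts
    ; increasing = s<s ∘ increasing
    ; related    = related
    }
    where open Chain c

  cons : {s : Fin (suc n) → A} {b : Fin n} →
         s zero R s (suc b) → Chain (s ∘ suc) m b → Chain s (suc m) zero
  cons {n} {m} {s} r c = record
    { pos = pos′ ; starts = refl ; increasing = increasing′ ; related = related′ }
    where
    open Chain c
    pos′ : Fin (suc (suc m)) → Fin (suc n)
    pos′ zero = zero
    pos′ (suc i) = suc (pos i)
    increasing′ : pos′ Preserves _<ᶠ_ ⟶ _<ᶠ_
    increasing′ {zero} {suc j} _ = z<s
    increasing′ {suc i} {suc j} i<j = s<s (increasing (s<s⁻¹ i<j))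
    related′ : ∀ {i j} → i <ᶠ j → s (pos′ i) R s (pos′ j)
    related′ {zero} {suc zero} _ = subst (λ b → s zero R s (suc b)) (sym starts) r
    related′ {zero} {suc (suc j)} _ = R-trans (related′ {zero} {suc zero} z<s) (related z<s)
    related′ {suc i} {suc j} i<j = related (s<s⁻¹ i<j)

  truncate : {s : Fin n → A} {a : Fin n} → k ≤ m → Chain s m a → Chain s k a
  truncate k≤m c = record
    { pos        = pos ∘ inject
    ; starts     = starts
    ; increasing = increasing ∘ inject-<
    ; related    = related ∘ inject-<
    }
    where
    open Chain c
    inject : Fin (suc _) → Fin (suc _)
    inject i = inject≤ i (s≤s k≤m)
    inject-< : inject Preserves _<ᶠ_ ⟶ _<ᶠ_
    inject-< {i} {j} = subst₂ _<_ (sym (Fin.toℕ-inject≤ i (s≤s k≤m))) (sym (Fin.toℕ-inject≤ j (s≤s k≤m)))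

  record Labelling (s : Fin n → A) : Set where
    field
      ℓ : Fin n → ℕ
      chain : ∀ a → Chain s (ℓ a) a
      ℓ-decreasing : ∀ {a b} → a <ᶠ b → s a R s b → ℓ b < ℓ a

  labelling : (s : Fin n → A) → Labelling s
  labelling {zero} s = record { ℓ = λ () ; chain = λ () ; ℓ-decreasing = λ { {()} } }
  labelling {suc n} s = record { ℓ = ℓ′ ; chain = chain′ ; ℓ-decreasing = ℓ′-decreasing }
    where
    open Labelling (labelling (s ∘ suc))
    candidate : Fin n → ∃ λ m → Chain s m zero
    candidate b with R? (s zero) (s (suc b))
    ... | yes r = suc (ℓ b) , cons r (chain b)
    ... | no _ = 0 , singleton
    candidate-length : ∀ {b} → s zero R s (suc b) → suc (ℓ b) ≤ proj₁ (candidate b)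
    candidate-length {b} r with R? (s zero) (s (suc b))
    ... | yes _ = ℕ.≤-refl
    ... | no ¬r = contradiction r ¬r
    longest : ∃ λ m → Chain s m zero
    longest = argmax proj₁ (0 , singleton) (List.tabulate candidate)
    ℓ′ : Fin (suc n) → ℕ
    ℓ′ zero = proj₁ longest
    ℓ′ (suc b) = ℓ b
    chain′ : ∀ a → Chain s (ℓ′ a) a
    chain′ zero = proj₂ longest
    chain′ (suc b) = shift (chain b)
    ℓ′-decreasing : ∀ {a b} → a <ᶠ b → s a R s b → ℓ′ b < ℓ′ a
    ℓ′-decreasing {zero} {suc b} _ r = ℕ.≤-trans (candidate-length r)
      (All.lookup (f[xs]≤f[argmax] {f = proj₁} (0 , singleton) (List.tabulate candidate)) (∈-tabulate⁺ b))
    ℓ′-decreasing {suc a} {suc b} a<b r = ℓ-decreasing (s<s⁻¹ a<b) r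

-- Seidenberg's argument: label each position by the lengths of the longest increasing and
-- decreasing chains starting there.  Of two positions, the earlier one extends a chain of
-- the later one, so the label pairs differ; by pigeonhole some label reaches k when n > k².
module _ {n} (π : Perm n) where
  private
    module ↑ = Chains {Fin n} _<ᶠ_ Fin._<?_ Fin.<-trans
    module ↓ = Chains {Fin n} _>_ (λ x y → y Fin.<? x) (λ x>y y>z → Fin.<-trans y>z x>y)
    open ↑.Labelling (↑.labelling (π ⟨_⟩))
      renaming (ℓ to ℓ↑; chain to chain↑; ℓ-decreasing to ℓ↑-decreasing)
    open ↓.Labelling (↓.labelling (π ⟨_⟩))
      renaming (ℓ to ℓ↓; chain to chain↓; ℓ-decreasing to ℓ↓-decreasing)

    long↑⇒incr : ∀ {a} → k ≤ ℓ↑ a → Contains π (incr (suc k))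
    long↑⇒incr {a = a} k≤ℓ = increasing-subsequence⇒incr π pos increasing related
      where open ↑.Chain (↑.truncate k≤ℓ (chain↑ a))

    long↓⇒decr : ∀ {a} → k ≤ ℓ↓ a → Contains π (decr (suc k))
    long↓⇒decr {a = a} k≤ℓ = decreasing-subsequence⇒decr π pos increasing related
      where open ↓.Chain (↓.truncate k≤ℓ (chain↓ a))

    labels-differ : ∀ {a b} → a <ᶠ b → ℓ↑ a ≡ ℓ↑ b → ℓ↓ a ≡ ℓ↓ b → ⊥
    labels-differ {a} {b} a<b eq↑ eq↓ with Fin.<-cmp (π ⟨ a ⟩) (π ⟨ b ⟩)
    ... | tri< πa<πb _ _ = ℕ.<-irrefl (sym eq↑) (ℓ↑-decreasing a<b πa<πb)
    ... | tri≈ _ πa≡πb _ = Fin.<-irrefl (⟨⟩-injective π πa≡πb) a<b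
    ... | tri> _ _ πa>πb = ℕ.<-irrefl (sym eq↓) (ℓ↓-decreasing a<b πa>πb)

    all-short-impossible : k * k < n → (∀ a → ℓ↑ a < k) → (∀ a → ℓ↓ a < k) → ⊥
    all-short-impossible k²<n short↑ short↓
      with a , b , a<b , same ←
             Fin.pigeonhole k²<n (λ a → combine (fromℕ< (short↑ a)) (fromℕ< (short↓ a)))
      with eq↑ , eq↓ ← Fin.combine-injective _ _ _ _ same
      = labels-differ a<b (Fin.fromℕ<-injective _ _ (short↑ a) (short↑ b) eq↑)
                          (Fin.fromℕ<-injective _ _ (short↓ a) (short↓ b) eq↓)

  erdős-szekeres : k * k < n → Contains π (incr (suc k)) ⊎ Contains π (decr (suc k))
  erdős-szekeres {k} k²<n with Fin.any? (λ a → k ℕ.≤? ℓ↑ a) | Fin.any? (λ a → k ℕ.≤? ℓ↓ a)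
  ... | yes (_ , k≤ℓ) | _ = inj₁ (long↑⇒incr k≤ℓ)
  ... | no _ | yes (_ , k≤ℓ) = inj₂ (long↓⇒decr k≤ℓ)
  ... | no ¬long↑ | no ¬long↓ = ⊥-elim (all-short-impossible k²<n
    (λ a → ℕ.≰⇒> (¬long↑ ∘ (a ,_))) (λ a → ℕ.≰⇒> (¬long↓ ∘ (a ,_))))

-- Positions of the game

reverseClosed : {F : PatSet k} → (∀ {p} → F p → F (rev p)) → ReverseClosed F
reverseClosed {F = F} closed p = closed , λ Frp → subst F (rev-involutive p) (closed Frp)

legal-⊆ : {X Y : Position n} → X ⊆′ Y → (p : Perm k) → LegalMove X p → LegalMove Y p
legal-⊆ X⊆Y _ (π , Xπ , π⊇p) = π , X⊆Y π Xπ , π⊇p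

after-≐ : {X Y : Position n} → X ≐′ Y → (p : Perm k) → (X after p) ≐′ (Y after p)
after-≐ (X⊆Y , Y⊆X) _ = (λ π → map₁ (X⊆Y π)) , (λ π → map₁ (Y⊆X π))

wins-resp-≐ : {X Y : Position n} → X ≐′ Y → ReverseStrategyWins k X → ReverseStrategyWins k Y
wins-resp-≐ X≐Y (wins strategy) = wins λ p legal →
  let reply , continue = strategy p (legal-⊆ (proj₂ X≐Y) p legal)
  in legal-⊆ (proj₁ (after-≐ X≐Y p)) (rev p) reply ,
     wins-resp-≐ (after-≐ (after-≐ X≐Y p) (rev p)) continue

reverseStrategyWins⇒P : {X : Position n} → ReverseStrategyWins k X → IsP k X
reverseStrategyWins⇒P (wins strategy) = allMovesToN λ p legal →
  moveToP (rev p) (proj₁ (strategy p legal)) (reverseStrategyWins⇒P (proj₂ (strategy p legal)))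

empty⇒wins : {X : Position n} → (∀ π → ¬ X π) → ReverseStrategyWins k X
empty⇒wins empty = wins λ { p (π , Xπ , _) → ⊥-elim (empty π Xπ) }

Av-∷ : (p : Perm k) (L : List (Perm k)) → Av n (_∈ p ∷ L) ≐′ (Av n (_∈ L) after p)
Av-∷ p L = (λ _ av → (λ q q∈L → av q (there q∈L)) , av _ (here refl))
           , λ { _ (av , π∌p) q (here refl) → π∌p ; _ (av , π∌p) q (there q∈L) → av q q∈L }

Av-∪｛｝ : (F : PatSet k) (p : Perm k) → Av n (F ∪｛ p ｝) ≐′ (Av n F after p)
Av-∪｛｝ F p = (λ _ av → (λ q Fq → av q (inj₁ Fq)) , av _ (inj₂ refl))
              , λ { _ (av , π∌p) q (inj₁ Fq) → av q Fq ; _ (av , π∌p) q (inj₂ refl) → π∌p }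

legal⇒∉ : {p : Perm k} {L : List (Perm k)} → LegalMove (Av n (_∈ L)) p → p ∉ L
legal⇒∉ (π , av , π⊇p) p∈L = av _ p∈L π⊇p

record Admissible (L : List (Perm k)) : Set where
  field
    reverse-closed : ReverseClosed (_∈ L)
    nonmonotone : All (¬_ ∘ Monotone) L
    unique : Unique L

  monotone∉ : {q : Perm k} → Monotone q → q ∉ L
  monotone∉ mono q∈L = All.lookup nonmonotone q∈L mono

admissible-[] : Admissible {k} []
admissible-[] = record { reverse-closed = reverseClosed λ () ; nonmonotone = [] ; unique = [] }

admissible-∷ : {p : Perm k} {L : List (Perm k)} → Admissible L → ¬ Monotone p →
               p ∉ L → rev p ∉ p ∷ L → Admissible (rev p ∷ p ∷ L)
admissible-∷ {p = p} {L} adm ¬mono p∉L rev∉ = record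
  { reverse-closed = reverseClosed closed
  ; nonmonotone = rev-nonmonotone ¬mono ∷ ¬mono ∷ nonmonotone
  ; unique = ¬Any⇒All¬ _ rev∉ ∷ ¬Any⇒All¬ _ p∉L ∷ unique
  }
  where
  open Admissible adm
  closed : ∀ {q} → q ∈ rev p ∷ p ∷ L → rev q ∈ rev p ∷ p ∷ L
  closed (here refl) = there (here (rev-involutive p))
  closed (there (here refl)) = here refl
  closed (there (there q∈L)) = there (there (proj₁ (reverse-closed _) q∈L))

-- The reverse strategy

encode : Perm k → Fin (k ^ k)
encode p = funToFin (p ⟨_⟩)

encode-injective : {p q : Perm k} → encode p ≡ encode q → p ≡ q
encode-injective {p = p} {q} eq = perm-ext λ i → begin
  p ⟨ i ⟩               ≡⟨ Fin.finToFun-funToFin (p ⟨_⟩) i ⟨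
  finToFun (encode p) i ≡⟨ cong (λ c → finToFun c i) eq ⟩
  finToFun (encode q) i ≡⟨ Fin.finToFun-funToFin (q ⟨_⟩) i ⟩
  q ⟨ i ⟩               ∎
  where open ≡-Reasoning

Unique⇒lookup-injective : {A : Set} {xs : List A} → Unique xs →
                          ∀ {i j} → List.lookup xs i ≡ List.lookup xs j → i ≡ j
Unique⇒lookup-injective (_ ∷ _) {zero} {zero} _ = refl
Unique⇒lookup-injective (x≢xs ∷ _) {zero} {suc j} eq = contradiction eq (All.lookup x≢xs (∈-lookup j))
Unique⇒lookup-injective (x≢xs ∷ _) {suc i} {zero} eq = contradiction (sym eq) (All.lookup x≢xs (∈-lookup i))
Unique⇒lookup-injective (_ ∷ xs!) {suc i} {suc j} eq = cong suc (Unique⇒lookup-injective xs! eq)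

unique-length≤ : {L : List (Perm k)} → Unique L → length L ≤ k ^ k
unique-length≤ L! = Fin.injective⇒≤ (Unique⇒lookup-injective L! ∘ encode-injective)

ReverseReplyLegal : (k n : ℕ) → Set₁
ReverseReplyLegal k n = ∀ (F : PatSet k) → ReverseClosed F → ¬ F (incr k) → ¬ F (decr k) →
  ∀ (p : Perm k) → ¬ F p → ¬ Monotone p → LegalFrom n F p → LegalFrom n (F ∪｛ p ｝) (rev p)

module ReverseStrategy {k n : ℕ} (incr≢decr : incr k ≢ decr k)
  (unavoidable : ∀ (π : Perm n) → Contains π (incr k) ⊎ Contains π (decr k))
  (reply-legal : ReverseReplyLegal k n) where

  incr-contains-incr : Contains (incr n) (incr k)
  incr-contains-incr with unavoidable (incr n)
  ... | inj₁ incr⊇incr = incr⊇incr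
  ... | inj₂ incr⊇decr = contradiction (sym (incr-contains⇒incr incr⊇decr)) incr≢decr

  decr-contains-decr : Contains (decr n) (decr k)
  decr-contains-decr with unavoidable (decr n)
  ... | inj₁ decr⊇incr = contradiction (decr-contains⇒decr decr⊇incr) incr≢decr
  ... | inj₂ decr⊇decr = decr⊇decr

  incr∈Av : {L : List (Perm k)} → Admissible L → Av n (_∈ L) (incr n)
  incr∈Av adm q q∈L incr⊇q = Admissible.monotone∉ adm (inj₁ (incr-contains⇒incr incr⊇q)) q∈L

  decr∈Av : {L : List (Perm k)} → Admissible L → Av n (_∈ L) (decr n)
  decr∈Av adm q q∈L decr⊇q = Admissible.monotone∉ adm (inj₂ (decr-contains⇒decr decr⊇q)) q∈L

  reply-to-monotone : {p : Perm k} {L : List (Perm k)} → Admissible L → Monotone p →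
                      LegalMove (Av n (_∈ L) after p) (rev p)
  reply-to-monotone adm (inj₁ refl) =
    decr n , (decr∈Av adm , incr≢decr ∘ decr-contains⇒decr) ,
    subst (Contains (decr n)) (sym rev-incr) decr-contains-decr
  reply-to-monotone adm (inj₂ refl) =
    incr n , (incr∈Av adm , incr≢decr ∘ sym ∘ incr-contains⇒incr) ,
    subst (Contains (incr n)) (sym rev-decr) incr-contains-incr

  monotone-pair-exhausts : {X : Position n} {p : Perm k} → Monotone p →
                           ∀ π → ¬ ((X after p) after rev p) π
  monotone-pair-exhausts (inj₁ refl) π ((_ , π∌incr) , π∌rev) =
    [ π∌incr , subst (Avoids π) rev-incr π∌rev ]′ (unavoidable π)
  monotone-pair-exhausts (inj₂ refl) π ((_ , π∌decr) , π∌rev) =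
    [ subst (Avoids π) rev-decr π∌rev , π∌decr ]′ (unavoidable π)

  -- The forbidden patterns are distinct, so length L ≤ k ^ k and the fuel cannot run out.
  wins-from : ∀ fuel {L : List (Perm k)} → Admissible L → k ^ k < length L + fuel →
              ReverseStrategyWins k (Av n (_∈ L))
  wins-from zero adm bound = ⊥-elim (ℕ.<⇒≱ bound
    (subst (_≤ k ^ k) (sym (ℕ.+-identityʳ _)) (unique-length≤ (Admissible.unique adm))))
  wins-from (suc fuel) {L} adm bound = wins reply
    where
    open Admissible adm
    X = Av n (_∈ L)
    reply : ∀ p → LegalMove X p →
            LegalMove (X after p) (rev p) × ReverseStrategyWins k ((X after p) after rev p)
    reply p legal with monotone? p
    ... | yes mono = reply-to-monotone adm mono , empty⇒wins (monotone-pair-exhausts mono)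
    ... | no ¬mono = reply-legal′ ,
                     wins-resp-≐ (after-≐ (Av-∷ p L) (rev p))
                       (wins-resp-≐ (Av-∷ (rev p) (p ∷ L)) (wins-from fuel adm′ bound′))
      where
      reply-legal′ : LegalMove (X after p) (rev p)
      reply-legal′ = legal-⊆ (proj₁ (Av-∪｛｝ (_∈ L) p)) (rev p)
        (reply-legal (_∈ L) reverse-closed (monotone∉ (inj₁ refl)) (monotone∉ (inj₂ refl))
                     p (legal⇒∉ legal) ¬mono legal)
      adm′ : Admissible (rev p ∷ p ∷ L)
      adm′ = admissible-∷ adm ¬mono (legal⇒∉ legal)
        (legal⇒∉ (legal-⊆ (proj₂ (Av-∷ p L)) (rev p) reply-legal′))
      bound′ : k ^ k < length (rev p ∷ p ∷ L) + fuel
      bound′ = ℕ.≤-trans bound (ℕ.≤-trans (ℕ.≤-reflexive (ℕ.+-suc (length L) fuel)) (ℕ.n≤1+n _))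

  wins-on-Sₙ : ReverseStrategyWins k (Sₙ n)
  wins-on-Sₙ = wins-resp-≐ ((λ _ _ → tt) , λ _ _ _ ())
    (wins-from (suc (k ^ k)) admissible-[] ℕ.≤-refl)

corollary2p13 : (k n : ℕ) → 2 ≤ k → (k ∸ 1) * (k ∸ 1) + 1 ≤ n →
    (∀ (F : PatSet k) → ReverseClosed F → ¬ F (incr k) → ¬ F (decr k) →
       ∀ (p : Perm k) → ¬ F p → ¬ Monotone p → LegalFrom n F p →
       LegalFrom n (F ∪｛ p ｝) (rev p)) →
    ReverseStrategyWins k (Sₙ n) × IsP k (Sₙ n)
corollary2p13 (suc zero) n (s≤s ())
corollary2p13 (suc (suc k)) n _ bound reply-legal = winning , reverseStrategyWins⇒P winning
  where
  k²<n : suc k * suc k < n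
  k²<n = subst (_≤ n) (ℕ.+-comm (suc k * suc k) 1) bound
  winning : ReverseStrategyWins (suc (suc k)) (Sₙ n)
  winning = ReverseStrategy.wins-on-Sₙ incr-≢-decr (λ π → erdős-szekeres π k²<n) reply-legal
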